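{- Let $m\ge2$ and $\lambda=(m,\ldots,m,0)$ (with $m-1$ parts equal to $m$), a partition of $m(m-1)$. Then the Newton polytope $\mathrm{Newt}(s_\lambda(x_1,\ldots,x_m))$ is reflexive.
   Context: $\mathrm{Newt}(s_\lambda(x_1,\ldots,x_m))$ is the convex hull in $\mathbb{R}^m$ of the exponent vectors of the Schur polynomial $s_\lambda(x_1,\ldots,x_m)=\sum_T\mathbf{x}^T$ (sum over semistandard Young tableaux of shape $\lambda$ with entries in $\{1,\ldots,m\}$); it equals the convex hull of the $S_m$-orbit of $(\lambda_1,\ldots,\lambda_m)$. Reflexivity (for possibly non-full-dimensional lattice polytopes): a lattice polytope $\mathcal{P}\subset\mathbb{R}^m$ is reflexive if there is a lattice point $\mathbf{p}$ in its relative interior such that $\mathbf{p}$ is at lattice distance $1$ from every facet, i.e. for each facet $F$ there are no lattice points of the affine span $\mathrm{aff}(\mathcal{P})$ strictly between the affine span of $F$ (within $\mathrm{aff}(\mathcal{P})$) and its parallel translate through $\mathbf{p}$. Equivalently, after a lattice-preserving affine identification of $\mathrm{aff}(\mathcal{P})\cap\mathbb{Z}^m$ with $\mathbb{Z}^k$ and translation by $-\mathbf{p}$, $\mathcal{P}$ becomes a reflexive polytope in $\mathbb{R}^k$ (one with $\mathbf{0}$ in its interior whose polar dual is a lattice polytope).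
   Formalization: Points of ℝ^m are replaced by points with rational coordinates, so the Newton polytope, its affine span and relative interior, and the facet hyperplanes' normals and offsets are taken over ℚ. -}

module Defs where

open import Data.Nat as ℕ using (ℕ; zero; suc; _<ᵇ_)
open import Data.Integer using (ℤ; +_)
open import Data.Rational using (ℚ; _+_; _*_; _-_; _≤_; _<_; _/_; 0ℚ; 1ℚ)
open import Data.Fin as Fin using (Fin; toℕ; _≟_)
open import Data.Bool using (Bool; if_then_else_)
open import Data.Product using (Σ; ∃; _×_)
open import Relation.Nullary using (¬_; does)
open import Relation.Binary.PropositionalEquality using (_≡_)

-- Points of ℚ^m (rational points; all polytopes here have rational vertices)
Point : ℕ → Set
Point m = Fin m → ℚ

sumF : ∀ {k} → (Fin k → ℚ) → ℚ
sumF {zero}  f = 0ℚ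
sumF {suc k} f = f Fin.zero + sumF (λ i → f (Fin.suc i))

dot : ∀ {m} → Point m → Point m → ℚ
dot a x = sumF (λ j → a j * x j)

ℕ→ℚ : ℕ → ℚ
ℕ→ℚ n = + n / 1

IsInt : ℚ → Set
IsInt q = ∃ λ (z : ℤ) → q ≡ z / 1

LatticePt : ∀ {m} → Point m → Set
LatticePt x = ∀ j → IsInt (x j)

PSet : ℕ → Set₁
PSet m = Point m → Set

Hull : ∀ {m} → PSet m → PSet m
Hull {m} S x = Σ ℕ λ k → Σ (Fin k → Point m) λ v → Σ (Fin k → ℚ) λ w →
  (∀ i → S (v i)) × (∀ i → 0ℚ ≤ w i) × (sumF w ≡ 1ℚ) ×
  (∀ j → x j ≡ sumF (λ i → w i * v i j))

Aff : ∀ {m} → PSet m → PSet m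
Aff {m} S x = Σ ℕ λ k → Σ (Fin k → Point m) λ v → Σ (Fin k → ℚ) λ w →
  (∀ i → S (v i)) × (sumF w ≡ 1ℚ) ×
  (∀ j → x j ≡ sumF (λ i → w i * v i j))

AffIndep : ∀ {m k} → (Fin k → Point m) → Set
AffIndep {m} {k} v = ∀ (c : Fin k → ℚ) → sumF c ≡ 0ℚ →
  (∀ j → sumF (λ i → c i * v i j) ≡ 0ℚ) → ∀ i → c i ≡ 0ℚ

HasAffIndep : ∀ {m} → PSet m → ℕ → Set
HasAffIndep {m} S n = Σ (Fin n → Point m) λ v → (∀ i → S (v i)) × AffIndep v

HasDim : ∀ {m} → PSet m → ℕ → Set
HasDim S d = HasAffIndep S (suc d) × ¬ HasAffIndep S (suc (suc d))

-- relative interior of a convex set P (Rockafellar Thm 6.4 form):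
-- x ∈ P and every segment from a point y of P to x extends beyond x inside P
RelInt : ∀ {m} → PSet m → PSet m
RelInt P x = P x × (∀ y → P y → Σ ℚ λ ε → (0ℚ < ε) × P (λ j → x j + ε * (x j - y j)))

Supporting : ∀ {m} → PSet m → Point m → ℚ → Set
Supporting P a b = ∀ x → P x → b ≤ dot a x

Face : ∀ {m} → PSet m → Point m → ℚ → PSet m
Face P a b x = P x × (dot a x ≡ b)

IsFacet : ∀ {m} → PSet m → Point m → ℚ → Set
IsFacet P a b = Supporting P a b × Σ ℕ λ d → HasDim P (suc d) × HasDim (Face P a b) d

-- Reflexivity (possibly non-full-dimensional): a lattice point p in the relative
-- interior such that for every facet F = P ∩ {a·x = b} there is no lattice point z
-- of aff(P) strictly between aff(F) = aff(P) ∩ {a·x = b} and its parallel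
-- translate aff(P) ∩ {a·x = a·p} through p.
IsReflexive : ∀ {m} → PSet m → Set
IsReflexive {m} P = Σ (Point m) λ p → LatticePt p × RelInt P p ×
  (∀ a b → IsFacet P a b →
     ¬ (Σ (Point m) λ z → LatticePt z × Aff P z × (b < dot a z) × (dot a z < dot a p)))

-- Semistandard Young tableaux of shape sh (at most m rows, given as sh : Fin m → ℕ)
-- with entries in {1,…,m} (encoded as Fin m).  T i j is the entry in row i,
-- column j; only the cells j < sh i matter.
_<F_ : ∀ {m} → Fin m → Fin m → Set
i <F i' = toℕ i ℕ.< toℕ i'

_≤F_ : ∀ {m} → Fin m → Fin m → Set
i ≤F i' = toℕ i ℕ.≤ toℕ i'

IsSSYT : ∀ {m} → (Fin m → ℕ) → (Fin m → ℕ → Fin m) → Set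
IsSSYT {m} sh T =
  (∀ i j j' → j ℕ.≤ j' → j' ℕ.< sh i → T i j ≤F T i j') ×
  (∀ i i' j → i <F i' → j ℕ.< sh i' → T i j <F T i' j)

countBelow : ℕ → (ℕ → Bool) → ℕ
countBelow zero    f = 0
countBelow (suc n) f = countBelow n f ℕ.+ (if f n then 1 else 0)

sumℕ : ∀ {k} → (Fin k → ℕ) → ℕ
sumℕ {zero}  f = 0
sumℕ {suc k} f = f Fin.zero ℕ.+ sumℕ (λ i → f (Fin.suc i))

expo : ∀ {m} → (Fin m → ℕ) → (Fin m → ℕ → Fin m) → Fin m → ℕ
expo sh T k = sumℕ (λ i → countBelow (sh i) (λ j → does (T i j ≟ k)))

SchurExps : ∀ {m} → (Fin m → ℕ) → PSet m
SchurExps {m} sh x = Σ (Fin m → ℕ → Fin m) λ T → IsSSYT sh T × (∀ k → x k ≡ ℕ→ℚ (expo sh T k))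

Newt : ∀ {m} → (Fin m → ℕ) → PSet m
Newt sh = Hull (SchurExps sh)

lam : (m : ℕ) → Fin m → ℕ
lam m i = if suc (toℕ i) <ᵇ m then m else 0

-- The exponent vectors of s_λ satisfy 0 ≤ x_j ≤ m (column strictness allows at most one entry j per
-- column) and Σ x_j = m(m - 1). These constraints cut out the simplex whose vertices m(1 - e_k) are
-- themselves exponent vectors, so Newt is this (m - 1)-simplex, and (m - 1, …, m - 1) lies in its
-- relative interior. A supporting hyperplane whose slack is nonzero at two vertices cuts out a face
-- of dimension at most m - 3, so the facets are the faces x_k = m, and the centre lies at lattice
-- distance m - (m - 1) = 1 from each of them.

module Submission where

open import Defs
open import Algebra.Bundles using (CommutativeMonoid; CommutativeRing)
import Algebra.Properties.Semiring.Sum as SemiringSum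
open import Data.Bool using (Bool; true; false; if_then_else_; _∧_; T)
open import Data.Bool.Properties using (T-∧; T-≡)
open import Data.Empty using (⊥; ⊥-elim)
open import Data.Fin as Fin using (Fin; zero; suc; toℕ; punchIn; punchOut; pinch; fromℕ)
import Data.Fin.Properties as Finₚ
open import Data.Integer as ℤ using (ℤ)
import Data.Integer.Properties as ℤₚ
open import Data.Nat as ℕ using (ℕ; zero; suc; z≤n; s≤s)
import Data.Nat.Coprimality as Coprimality
import Data.Nat.Properties as ℕₚ
open import Data.Product using (Σ; ∃; _×_; _,_; proj₁; proj₂)
open import Data.Rational
  using (ℚ; NonZero; NonNegative; _+_; _*_; _-_; -_; _≤_; _<_; _/_; 0ℚ; 1ℚ; 1/_; mkℚ; toℚᵘ; *≤*; *<*;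
         ≢-nonZero; positive; nonNegative)
open import Data.Rational.Properties
open import Data.Rational.Solver using (module +-*-Solver)
import Data.Rational.Unnormalised as ℚᵘ
import Data.Rational.Unnormalised.Properties as ℚᵘₚ
open import Data.Sum using (inj₁; inj₂)
open import Function using (_∘_)
open import Function.Bundles using (Equivalence)
open import Relation.Binary.Definitions using (tri<; tri≈; tri>)
open import Relation.Binary.PropositionalEquality
open import Relation.Nullary using (¬_; Dec; yes; no; does)
open import Relation.Nullary.Decidable using (dec-false; decidable-stable)

open import Algebra.Properties.CommutativeSemigroup (CommutativeMonoid.commutativeSemigroup *-1-commutativeMonoid)
  using (x∙yz≈y∙xz)
open import Algebra.Properties.Group +-0-group using ()
  renaming (∙-cancelˡ to +-cancelˡ; x∙y⁻¹≈ε⇒x≈y to p-q≡0⇒p≡q)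

-- Finite sums

open SemiringSum (CommutativeRing.semiring +-*-commutativeRing)
  using (sum; ∑-distrib-+; ∑-comm; sum-remove; sum-cong-≗; *-distribˡ-sum)

sumF≗sum : ∀ {k} (f : Fin k → ℚ) → sumF f ≡ sum f
sumF≗sum {zero}  f = refl
sumF≗sum {suc k} f = cong (f zero +_) (sumF≗sum (f ∘ suc))

sumF-cong : ∀ {k} {f g : Fin k → ℚ} → (∀ i → f i ≡ g i) → sumF f ≡ sumF g
sumF-cong {zero}  f≗g = refl
sumF-cong {suc k} f≗g = cong₂ _+_ (f≗g zero) (sumF-cong (f≗g ∘ suc))

sumF-0 : ∀ k → sumF {k} (λ _ → 0ℚ) ≡ 0ℚ
sumF-0 zero    = refl
sumF-0 (suc k) = trans (+-identityˡ _) (sumF-0 k)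

sumF-+ : ∀ {k} (f g : Fin k → ℚ) → sumF (λ i → f i + g i) ≡ sumF f + sumF g
sumF-+ f g = begin
  sumF (λ i → f i + g i)  ≡⟨ sumF≗sum (λ i → f i + g i) ⟩
  sum (λ i → f i + g i)   ≡⟨ ∑-distrib-+ f g ⟩
  sum f + sum g           ≡⟨ cong₂ _+_ (sumF≗sum f) (sumF≗sum g) ⟨
  sumF f + sumF g         ∎
  where open ≡-Reasoning

sumF-*ˡ : ∀ {k} c (f : Fin k → ℚ) → sumF (λ i → c * f i) ≡ c * sumF f
sumF-*ˡ c f = begin
  sumF (λ i → c * f i)  ≡⟨ sumF≗sum (λ i → c * f i) ⟩
  sum (λ i → c * f i)   ≡⟨ *-distribˡ-sum c f ⟨
  c * sum f             ≡⟨ cong (c *_) (sumF≗sum f) ⟨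
  c * sumF f            ∎
  where open ≡-Reasoning

sumF-*ʳ : ∀ {k} c (f : Fin k → ℚ) → sumF (λ i → f i * c) ≡ sumF f * c
sumF-*ʳ c f = trans (sumF-cong (λ i → *-comm (f i) c)) (trans (sumF-*ˡ c f) (*-comm c _))

sumF-neg : ∀ {k} (f : Fin k → ℚ) → sumF (λ i → - f i) ≡ - sumF f
sumF-neg {zero}  f = refl
sumF-neg {suc k} f =
  trans (cong (- f zero +_) (sumF-neg (f ∘ suc))) (sym (neg-distrib-+ (f zero) (sumF (f ∘ suc))))

sumF-- : ∀ {k} (f g : Fin k → ℚ) → sumF (λ i → f i - g i) ≡ sumF f - sumF g
sumF-- f g = trans (sumF-+ f (λ i → - g i)) (cong (sumF f +_) (sumF-neg g))

sumF-comm : ∀ {k l} (f : Fin k → Fin l → ℚ) →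
            sumF (λ i → sumF (f i)) ≡ sumF (λ j → sumF (λ i → f i j))
sumF-comm f = begin
  sumF (λ i → sumF (f i))          ≡⟨ sumF≗sum (λ i → sumF (f i)) ⟩
  sum (λ i → sumF (f i))           ≡⟨ sum-cong-≗ (λ i → sumF≗sum (f i)) ⟩
  sum (λ i → sum (f i))            ≡⟨ ∑-comm f ⟩
  sum (λ j → sum (λ i → f i j))    ≡⟨ sum-cong-≗ (λ j → sumF≗sum (λ i → f i j)) ⟨
  sum (λ j → sumF (λ i → f i j))   ≡⟨ sumF≗sum (λ j → sumF (λ i → f i j)) ⟨
  sumF (λ j → sumF (λ i → f i j))  ∎
  where open ≡-Reasoning

sumF-remove : ∀ {k} (f : Fin (suc k) → ℚ) i → sumF f ≡ f i + sumF (f ∘ punchIn i)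
sumF-remove f i = begin
  sumF f                      ≡⟨ sumF≗sum f ⟩
  sum f                       ≡⟨ sum-remove f ⟩
  f i + sum (f ∘ punchIn i)   ≡⟨ cong (f i +_) (sumF≗sum (f ∘ punchIn i)) ⟨
  f i + sumF (f ∘ punchIn i)  ∎
  where open ≡-Reasoning

sumF-remove-0 : ∀ {k} (f : Fin (suc k) → ℚ) i → f i ≡ 0ℚ → sumF f ≡ sumF (f ∘ punchIn i)
sumF-remove-0 f i fi≡0 = trans (sumF-remove f i) (trans (cong (_+ sumF (f ∘ punchIn i)) fi≡0) (+-identityˡ _))

sumF-remove₂-0 : ∀ {k} (f : Fin (suc (suc k)) → ℚ) {i j} (i≢j : i ≢ j) → f i ≡ 0ℚ → f j ≡ 0ℚ →
                 sumF f ≡ sumF (f ∘ punchIn i ∘ punchIn (punchOut i≢j))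
sumF-remove₂-0 f {i} i≢j fi≡0 fj≡0 = trans (sumF-remove-0 f i fi≡0)
  (sumF-remove-0 (f ∘ punchIn i) (punchOut i≢j) (trans (cong f (Finₚ.punchIn-punchOut i≢j)) fj≡0))

sumF-single : ∀ {k} (f : Fin k → ℚ) i → (∀ j → j ≢ i → f j ≡ 0ℚ) → sumF f ≡ f i
sumF-single {suc k} f i f≡0 = begin
  sumF f                      ≡⟨ sumF-remove f i ⟩
  f i + sumF (f ∘ punchIn i)  ≡⟨ cong (f i +_) (sumF-cong {g = λ _ → 0ℚ} (λ j → f≡0 (punchIn i j) (Finₚ.punchInᵢ≢i i j))) ⟩
  f i + sumF {k} (λ _ → 0ℚ)   ≡⟨ cong (f i +_) (sumF-0 k) ⟩
  f i + 0ℚ                    ≡⟨ +-identityʳ (f i) ⟩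
  f i                         ∎
  where open ≡-Reasoning

sumF-mono-≤ : ∀ {k} {f g : Fin k → ℚ} → (∀ i → f i ≤ g i) → sumF f ≤ sumF g
sumF-mono-≤ {zero}  f≤g = ≤-refl
sumF-mono-≤ {suc k} f≤g = +-mono-≤ (f≤g zero) (sumF-mono-≤ (f≤g ∘ suc))

sumF-nonNeg : ∀ {k} {f : Fin k → ℚ} → (∀ i → 0ℚ ≤ f i) → 0ℚ ≤ sumF f
sumF-nonNeg {k} {f} 0≤f = subst (_≤ sumF f) (sumF-0 k) (sumF-mono-≤ 0≤f)

sumF-nonNeg≡0 : ∀ {k} {f : Fin k → ℚ} → (∀ i → 0ℚ ≤ f i) → sumF f ≡ 0ℚ → ∀ i → f i ≡ 0ℚ
sumF-nonNeg≡0 {suc k} {f} 0≤f sum≡0 i = ≤-antisym fi≤0 (0≤f i)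
  where
  fi≤0 : f i ≤ 0ℚ
  fi≤0 = begin
    f i                         ≡⟨ +-identityʳ (f i) ⟨
    f i + 0ℚ                    ≤⟨ +-monoʳ-≤ (f i) (sumF-nonNeg (0≤f ∘ punchIn i)) ⟩
    f i + sumF (f ∘ punchIn i)  ≡⟨ sumF-remove f i ⟨
    sumF f                      ≡⟨ sum≡0 ⟩
    0ℚ                          ∎
    where open ≤-Reasoning

-- Integers and naturals inside ℚ

ℤ→ℚ : ℤ → ℚ
ℤ→ℚ z = z / 1

ℤ→ℚ≡mkℚ : ∀ z → ℤ→ℚ z ≡ mkℚ z 0 (Coprimality.sym (Coprimality.1-coprimeTo ℤ.∣ z ∣))
ℤ→ℚ≡mkℚ z = fromℚᵘ-toℚᵘ (mkℚ z 0 _)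

toℚᵘ-ℤ→ℚ : ∀ z → toℚᵘ (ℤ→ℚ z) ≡ ℚᵘ.mkℚᵘ z 0
toℚᵘ-ℤ→ℚ z = cong toℚᵘ (ℤ→ℚ≡mkℚ z)

ℤ→ℚ-+ : ∀ a b → ℤ→ℚ (a ℤ.+ b) ≡ ℤ→ℚ a + ℤ→ℚ b
ℤ→ℚ-+ a b = toℚᵘ-injective (begin
  toℚᵘ (ℤ→ℚ (a ℤ.+ b))
    ≡⟨ toℚᵘ-ℤ→ℚ (a ℤ.+ b) ⟩
  ℚᵘ.mkℚᵘ (a ℤ.+ b) 0
    ≈⟨ ℚᵘ.*≡* (cong (ℤ._* ℤ.+ 1) (sym (cong₂ ℤ._+_ (ℤₚ.*-identityʳ a) (ℤₚ.*-identityʳ b)))) ⟩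
  ℚᵘ.mkℚᵘ a 0 ℚᵘ.+ ℚᵘ.mkℚᵘ b 0
    ≡⟨ cong₂ ℚᵘ._+_ (toℚᵘ-ℤ→ℚ a) (toℚᵘ-ℤ→ℚ b) ⟨
  toℚᵘ (ℤ→ℚ a) ℚᵘ.+ toℚᵘ (ℤ→ℚ b)
    ≈⟨ toℚᵘ-homo-+ (ℤ→ℚ a) (ℤ→ℚ b) ⟨
  toℚᵘ (ℤ→ℚ a + ℤ→ℚ b) ∎)
  where open ℚᵘₚ.≃-Reasoning

ℤ→ℚ-* : ∀ a b → ℤ→ℚ (a ℤ.* b) ≡ ℤ→ℚ a * ℤ→ℚ b
ℤ→ℚ-* a b = toℚᵘ-injective (begin
  toℚᵘ (ℤ→ℚ (a ℤ.* b))                ≡⟨ toℚᵘ-ℤ→ℚ (a ℤ.* b) ⟩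
  ℚᵘ.mkℚᵘ (a ℤ.* b) 0                  ≈⟨ ℚᵘ.*≡* refl ⟩
  ℚᵘ.mkℚᵘ a 0 ℚᵘ.* ℚᵘ.mkℚᵘ b 0        ≡⟨ cong₂ ℚᵘ._*_ (toℚᵘ-ℤ→ℚ a) (toℚᵘ-ℤ→ℚ b) ⟨
  toℚᵘ (ℤ→ℚ a) ℚᵘ.* toℚᵘ (ℤ→ℚ b)      ≈⟨ toℚᵘ-homo-* (ℤ→ℚ a) (ℤ→ℚ b) ⟨
  toℚᵘ (ℤ→ℚ a * ℤ→ℚ b)                 ∎)
  where open ℚᵘₚ.≃-Reasoning

ℤ→ℚ-mono-≤ : ∀ {a b} → a ℤ.≤ b → ℤ→ℚ a ≤ ℤ→ℚ b
ℤ→ℚ-mono-≤ {a} {b} a≤b = subst₂ _≤_ (sym (ℤ→ℚ≡mkℚ a)) (sym (ℤ→ℚ≡mkℚ b))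
  (*≤* (subst₂ ℤ._≤_ (sym (ℤₚ.*-identityʳ a)) (sym (ℤₚ.*-identityʳ b)) a≤b))

ℤ→ℚ-mono-< : ∀ {a b} → a ℤ.< b → ℤ→ℚ a < ℤ→ℚ b
ℤ→ℚ-mono-< {a} {b} a<b = subst₂ _<_ (sym (ℤ→ℚ≡mkℚ a)) (sym (ℤ→ℚ≡mkℚ b))
  (*<* (subst₂ ℤ._<_ (sym (ℤₚ.*-identityʳ a)) (sym (ℤₚ.*-identityʳ b)) a<b))

ℤ→ℚ-cancel-< : ∀ {a b} → ℤ→ℚ a < ℤ→ℚ b → a ℤ.< b
ℤ→ℚ-cancel-< {a} {b} a<b = subst₂ ℤ._<_ (ℤₚ.*-identityʳ a) (ℤₚ.*-identityʳ b)
  (drop-*<* (subst₂ _<_ (ℤ→ℚ≡mkℚ a) (ℤ→ℚ≡mkℚ b) a<b))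

no-integer-between : ∀ {q} → IsInt q → ∀ k → ℤ→ℚ k < q → q < ℤ→ℚ k + 1ℚ → ⊥
no-integer-between (z , refl) k k<z z<k+1 = ℤₚ.<⇒≱ z<k+1′ (ℤₚ.i<j⇒suc[i]≤j (ℤ→ℚ-cancel-< {k} {z} k<z))
  where
  z<k+1′ : z ℤ.< ℤ.suc k
  z<k+1′ = ℤ→ℚ-cancel-< {z} {ℤ.suc k} (subst (ℤ→ℚ z <_) (trans (+-comm (ℤ→ℚ k) 1ℚ) (sym (ℤ→ℚ-+ (ℤ.+ 1) k))) z<k+1)

ℕ→ℚ-+ : ∀ a b → ℕ→ℚ (a ℕ.+ b) ≡ ℕ→ℚ a + ℕ→ℚ b
ℕ→ℚ-+ a b = ℤ→ℚ-+ (ℤ.+ a) (ℤ.+ b)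

ℕ→ℚ-* : ∀ a b → ℕ→ℚ (a ℕ.* b) ≡ ℕ→ℚ a * ℕ→ℚ b
ℕ→ℚ-* a b = trans (cong ℤ→ℚ (ℤₚ.pos-* a b)) (ℤ→ℚ-* (ℤ.+ a) (ℤ.+ b))

ℕ→ℚ-mono-≤ : ∀ {a b} → a ℕ.≤ b → ℕ→ℚ a ≤ ℕ→ℚ b
ℕ→ℚ-mono-≤ a≤b = ℤ→ℚ-mono-≤ (ℤ.+≤+ a≤b)

ℕ→ℚ-mono-< : ∀ {a b} → a ℕ.< b → ℕ→ℚ a < ℕ→ℚ b
ℕ→ℚ-mono-< a<b = ℤ→ℚ-mono-< (ℤ.+<+ a<b)

sumF-ℕ→ℚ : ∀ {k} (f : Fin k → ℕ) → sumF (ℕ→ℚ ∘ f) ≡ ℕ→ℚ (sumℕ f)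
sumF-ℕ→ℚ {zero}  f = refl
sumF-ℕ→ℚ {suc k} f = trans (cong (ℕ→ℚ (f zero) +_) (sumF-ℕ→ℚ (f ∘ suc))) (sym (ℕ→ℚ-+ (f zero) (sumℕ (f ∘ suc))))

sumF-const : ∀ k x → sumF {k} (λ _ → x) ≡ ℕ→ℚ k * x
sumF-const zero    x = sym (*-zeroˡ x)
sumF-const (suc k) x = begin
  x + sumF {k} (λ _ → x)   ≡⟨ cong (x +_) (sumF-const k x) ⟩
  x + ℕ→ℚ k * x            ≡⟨ cong (_+ ℕ→ℚ k * x) (*-identityˡ x) ⟨
  1ℚ * x + ℕ→ℚ k * x       ≡⟨ *-distribʳ-+ x 1ℚ (ℕ→ℚ k) ⟨
  (1ℚ + ℕ→ℚ k) * x         ≡⟨ cong (_* x) (ℕ→ℚ-+ 1 k) ⟨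
  ℕ→ℚ (suc k) * x          ∎
  where open ≡-Reasoning

p≤q⇒0≤q-p : ∀ {p q} → p ≤ q → 0ℚ ≤ q - p
p≤q⇒0≤q-p {p} {q} p≤q = subst (_≤ q - p) (+-inverseʳ p) (+-monoˡ-≤ (- p) p≤q)

p<q⇒0<q-p : ∀ {p q} → p < q → 0ℚ < q - p
p<q⇒0<q-p {p} {q} p<q = subst (_< q - p) (+-inverseʳ p) (+-monoˡ-< (- p) p<q)

q-p+p≡q : ∀ p q → q - p + p ≡ q
q-p+p≡q p q = trans (+-assoc q (- p) p) (trans (cong (q +_) (+-inverseˡ p)) (+-identityʳ q))

0≤q-p⇒p≤q : ∀ {p q} → 0ℚ ≤ q - p → p ≤ q
0≤q-p⇒p≤q {p} {q} 0≤q-p = subst₂ _≤_ (+-identityˡ p) (q-p+p≡q p q) (+-monoˡ-≤ p 0≤q-p)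

0<q-p⇒p<q : ∀ {p q} → 0ℚ < q - p → p < q
0<q-p⇒p<q {p} {q} 0<q-p = subst₂ _<_ (+-identityˡ p) (q-p+p≡q p q) (+-monoˡ-< p 0<q-p)

*-nonNeg : ∀ {p q} → 0ℚ ≤ p → 0ℚ ≤ q → 0ℚ ≤ p * q
*-nonNeg {p} {q} 0≤p 0≤q = nonNegative⁻¹ (p * q) {{nonNeg*nonNeg⇒nonNeg p {{nonNegative 0≤p}} q {{nonNegative 0≤q}}}}

*-cancelʳ-≡0 : ∀ {p q} → q ≢ 0ℚ → p * q ≡ 0ℚ → p ≡ 0ℚ
*-cancelʳ-≡0 {p} {q} q≢0 pq≡0 = begin
  p                ≡⟨ *-identityʳ p ⟨
  p * 1ℚ           ≡⟨ cong (p *_) (*-inverseʳ q) ⟨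
  p * (q * q⁻¹)    ≡⟨ *-assoc p q q⁻¹ ⟨
  p * q * q⁻¹      ≡⟨ cong (_* q⁻¹) pq≡0 ⟩
  0ℚ * q⁻¹         ≡⟨ *-zeroˡ q⁻¹ ⟩
  0ℚ               ∎
  where
  instance _ = ≢-nonZero q≢0
  q⁻¹ = 1/ q
  open ≡-Reasoning

-- Homogeneous linear systems

e₀ : ∀ {r} → Fin (suc r) → ℚ
e₀ zero    = 1ℚ
e₀ (suc _) = 0ℚ

sumF-*-e₀ : ∀ {r} (ρ : Fin (suc r) → ℚ) → sumF (λ i → ρ i * e₀ i) ≡ ρ zero
sumF-*-e₀ {r} ρ = begin
  ρ zero * 1ℚ + sumF (λ i → ρ (suc i) * 0ℚ)  ≡⟨ cong₂ _+_ (*-identityʳ (ρ zero)) (sumF-cong (λ i → *-zeroʳ (ρ (suc i)))) ⟩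
  ρ zero + sumF {r} (λ _ → 0ℚ)               ≡⟨ cong (ρ zero +_) (sumF-0 r) ⟩
  ρ zero + 0ℚ                                ≡⟨ +-identityʳ (ρ zero) ⟩
  ρ zero                                     ∎
  where open ≡-Reasoning

module Elimination {r} (p : Fin (suc r) → ℚ) .{{_ : NonZero (p zero)}} where

  eliminate : (Fin (suc r) → ℚ) → Fin r → ℚ
  eliminate ρ i = ρ (suc i) - (ρ zero * 1/ p zero) * p (suc i)

  backSubstitute : (Fin r → ℚ) → Fin (suc r) → ℚ
  backSubstitute c′ zero    = - (1/ p zero * sumF (λ i → p (suc i) * c′ i))
  backSubstitute c′ (suc i) = c′ i

  eliminate-pivot : ∀ i → eliminate p i ≡ 0ℚ
  eliminate-pivot i = begin
    p (suc i) - (p zero * 1/ p zero) * p (suc i)  ≡⟨ cong (λ x → p (suc i) - x * p (suc i)) (*-inverseʳ (p zero)) ⟩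
    p (suc i) - 1ℚ * p (suc i)                    ≡⟨ solve 1 (λ a → a :- con 1ℚ :* a := con 0ℚ) refl (p (suc i)) ⟩
    0ℚ                                            ∎
    where
    open ≡-Reasoning
    open +-*-Solver

  backSubstitute-solves : ∀ c′ ρ → sumF (λ i → eliminate ρ i * c′ i) ≡ 0ℚ →
                          sumF (λ i → ρ i * backSubstitute c′ i) ≡ 0ℚ
  backSubstitute-solves c′ ρ eliminated≡0 = begin
    ρ zero * - (1/ p zero * S) + R   ≡⟨ cong (ρ zero * - (1/ p zero * S) +_) R≡λS ⟩
    ρ zero * - (1/ p zero * S) + λ′ * S  ≡⟨ solve 3 (λ r q s → r :* (:- (q :* s)) :+ (r :* q) :* s := con 0ℚ) refl (ρ zero) (1/ p zero) S ⟩
    0ℚ                               ∎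
    where
    open ≡-Reasoning
    open +-*-Solver
    λ′ S R : ℚ
    λ′ = ρ zero * 1/ p zero
    S = sumF (λ i → p (suc i) * c′ i)
    R = sumF (λ i → ρ (suc i) * c′ i)
    eliminated≡ : sumF (λ i → eliminate ρ i * c′ i) ≡ R - λ′ * S
    eliminated≡ = begin
      sumF (λ i → eliminate ρ i * c′ i)
        ≡⟨ sumF-cong (λ i → solve 4 (λ x l y c → (x :- l :* y) :* c := x :* c :- l :* (y :* c)) refl (ρ (suc i)) λ′ (p (suc i)) (c′ i)) ⟩
      sumF (λ i → ρ (suc i) * c′ i - λ′ * (p (suc i) * c′ i))
        ≡⟨ sumF-- (λ i → ρ (suc i) * c′ i) (λ i → λ′ * (p (suc i) * c′ i)) ⟩
      R - sumF (λ i → λ′ * (p (suc i) * c′ i))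
        ≡⟨ cong (λ x → R - x) (sumF-*ˡ λ′ (λ i → p (suc i) * c′ i)) ⟩
      R - λ′ * S ∎
    R≡λS : R ≡ λ′ * S
    R≡λS = begin
      R                   ≡⟨ solve 2 (λ r s → r := (r :- s) :+ s) refl R (λ′ * S) ⟩
      R - λ′ * S + λ′ * S ≡⟨ cong (_+ λ′ * S) (trans (sym eliminated≡) eliminated≡0) ⟩
      0ℚ + λ′ * S         ≡⟨ +-identityˡ (λ′ * S) ⟩
      λ′ * S              ∎

-- Gaussian elimination on the first unknown.
kernel-nonTrivial : ∀ {t r} (A : Fin t → Fin r → ℚ) → t ℕ.< r →
  Σ (Fin r → ℚ) λ c → (∃ λ i → c i ≢ 0ℚ) × (∀ j → sumF (λ i → A j i * c i) ≡ 0ℚ)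
kernel-nonTrivial {zero} {suc r} A _ = e₀ , (zero , 1≢0) , λ ()
kernel-nonTrivial {suc t} {suc r} A (s≤s t<r) with Finₚ.all? (λ j → A j zero ≟ 0ℚ)
... | yes col₀≡0 = e₀ , (zero , 1≢0) , λ j → trans (sumF-*-e₀ (A j)) (col₀≡0 j)
... | no ¬col₀≡0 = backSubstitute c′ , (suc i , c′ᵢ≢0) , solves
  where
  pivot : ∃ λ j₀ → A j₀ zero ≢ 0ℚ
  pivot = Finₚ.¬∀⟶∃¬ (suc t) (λ j → A j zero ≡ 0ℚ) (λ j → A j zero ≟ 0ℚ) ¬col₀≡0
  j₀ : Fin (suc t)
  j₀ = proj₁ pivot
  instance
    pivot-nonZero : NonZero (A j₀ zero)
    pivot-nonZero = ≢-nonZero (proj₂ pivot)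
  open Elimination (A j₀)
  reduced : Σ (Fin r → ℚ) λ c′ → (∃ λ i → c′ i ≢ 0ℚ) × (∀ s → sumF (λ i → eliminate (A (punchIn j₀ s)) i * c′ i) ≡ 0ℚ)
  reduced = kernel-nonTrivial (λ s → eliminate (A (punchIn j₀ s))) t<r
  c′ : Fin r → ℚ
  c′ = proj₁ reduced
  i : Fin r
  i = proj₁ (proj₁ (proj₂ reduced))
  c′ᵢ≢0 : c′ i ≢ 0ℚ
  c′ᵢ≢0 = proj₂ (proj₁ (proj₂ reduced))
  c′-solves : ∀ s → sumF (λ i → eliminate (A (punchIn j₀ s)) i * c′ i) ≡ 0ℚ
  c′-solves = proj₂ (proj₂ reduced)
  solves : ∀ j → sumF (λ i → A j i * backSubstitute c′ i) ≡ 0ℚ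
  solves j with j Finₚ.≟ j₀
  ... | yes refl = backSubstitute-solves c′ (A j₀) (trans (sumF-cong (λ i → trans (cong (_* c′ i) (eliminate-pivot i)) (*-zeroˡ (c′ i)))) (sumF-0 r))
  ... | no j≢j₀ = subst (λ q → sumF (λ i → A q i * backSubstitute c′ i) ≡ 0ℚ) (Finₚ.punchIn-punchOut (j≢j₀ ∘ sym))
                    (backSubstitute-solves c′ (A (punchIn j₀ s)) (c′-solves s))
    where s = punchOut (j≢j₀ ∘ sym)

-- Affine and convex combinations

sumF-*ˡ-comm : ∀ {k l} (c : Fin k → ℚ) (f : Fin k → Fin l → ℚ) →
               sumF (λ i → c i * sumF (f i)) ≡ sumF (λ j → sumF (λ i → c i * f i j))
sumF-*ˡ-comm c f = trans (sumF-cong (λ i → sym (sumF-*ˡ (c i) (f i)))) (sumF-comm (λ i j → c i * f i j))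

affineCombination-sumF : ∀ {m k} (v : Fin k → Point m) (w : Fin k → ℚ) {K} →
  sumF w ≡ 1ℚ → (∀ i → sumF (v i) ≡ K) → sumF (λ j → sumF (λ i → w i * v i j)) ≡ K
affineCombination-sumF v w {K} w-sum v-sum = begin
  sumF (λ j → sumF (λ i → w i * v i j))  ≡⟨ sumF-*ˡ-comm w v ⟨
  sumF (λ i → w i * sumF (v i))          ≡⟨ sumF-cong (λ i → cong (w i *_) (v-sum i)) ⟩
  sumF (λ i → w i * K)                   ≡⟨ sumF-*ʳ K w ⟩
  sumF w * K                             ≡⟨ cong (_* K) w-sum ⟩
  1ℚ * K                                 ≡⟨ *-identityˡ K ⟩
  K                                      ∎
  where open ≡-Reasoning

convexCombination-≤ : ∀ {k} (w f : Fin k → ℚ) {c} →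
  (∀ i → 0ℚ ≤ w i) → sumF w ≡ 1ℚ → (∀ i → f i ≤ c) → sumF (λ i → w i * f i) ≤ c
convexCombination-≤ w f {c} 0≤w w-sum f≤c = begin
  sumF (λ i → w i * f i)  ≤⟨ sumF-mono-≤ (λ i → *-monoˡ-≤-nonNeg (w i) {{nonNegative (0≤w i)}} (f≤c i)) ⟩
  sumF (λ i → w i * c)    ≡⟨ sumF-*ʳ c w ⟩
  sumF w * c              ≡⟨ cong (_* c) w-sum ⟩
  1ℚ * c                  ≡⟨ *-identityˡ c ⟩
  c                       ∎
  where open ≤-Reasoning

dot-affineCombination : ∀ {m k} (v : Fin k → Point m) (w : Fin k → ℚ) {y : Point m} →
  sumF w ≡ 1ℚ → (∀ j → y j ≡ sumF (λ i → w i * v i j)) →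
  ∀ a b → sumF (λ i → w i * (dot a (v i) - b)) ≡ dot a y - b
dot-affineCombination v w {y} w-sum y≡ a b = begin
  sumF (λ i → w i * (dot a (v i) - b))
    ≡⟨ sumF-cong (λ i → *-distribˡ-+ (w i) (dot a (v i)) (- b)) ⟩
  sumF (λ i → w i * dot a (v i) + w i * - b)
    ≡⟨ sumF-+ (λ i → w i * dot a (v i)) (λ i → w i * - b) ⟩
  sumF (λ i → w i * dot a (v i)) + sumF (λ i → w i * - b)
    ≡⟨ cong₂ _+_ a·y≡ (trans (sumF-*ʳ (- b) w) (trans (cong (_* - b) w-sum) (*-identityˡ (- b)))) ⟩
  dot a y - b ∎
  where
  open ≡-Reasoning
  a·y≡ : sumF (λ i → w i * dot a (v i)) ≡ dot a y
  a·y≡ = begin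
    sumF (λ i → w i * dot a (v i))                 ≡⟨ sumF-*ˡ-comm w (λ i j → a j * v i j) ⟩
    sumF (λ j → sumF (λ i → w i * (a j * v i j)))  ≡⟨ sumF-cong (λ j → sumF-cong (λ i → x∙yz≈y∙xz (w i) (a j) (v i j))) ⟩
    sumF (λ j → sumF (λ i → a j * (w i * v i j)))  ≡⟨ sumF-cong (λ j → trans (sumF-*ˡ (a j) (λ i → w i * v i j)) (cong (a j *_) (sym (y≡ j)))) ⟩
    dot a y                                        ∎

affineCombinations-¬AffIndep : ∀ {m t r} (u : Fin t → Point m) (y : Fin r → Point m) (w : Fin r → Fin t → ℚ) →
  (∀ i → sumF (w i) ≡ 1ℚ) → (∀ i j → y i j ≡ sumF (λ s → w i s * u s j)) → t ℕ.< r → ¬ AffIndep y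
affineCombinations-¬AffIndep {t = t} {r} u y w w-sum y≡ t<r indep = cᵢ≢0 (indep c Σc≡0 Σcy≡0 i)
  where
  open ≡-Reasoning
  kernel : Σ (Fin r → ℚ) λ c → (∃ λ i → c i ≢ 0ℚ) × (∀ s → sumF (λ i → w i s * c i) ≡ 0ℚ)
  kernel = kernel-nonTrivial (λ s i → w i s) t<r
  c : Fin r → ℚ
  c = proj₁ kernel
  i : Fin r
  i = proj₁ (proj₁ (proj₂ kernel))
  cᵢ≢0 : c i ≢ 0ℚ
  cᵢ≢0 = proj₂ (proj₁ (proj₂ kernel))
  Σwc≡0 : ∀ s → sumF (λ i → w i s * c i) ≡ 0ℚ
  Σwc≡0 = proj₂ (proj₂ kernel)

  regroup : (g : Fin t → ℚ) → sumF (λ i → c i * sumF (λ s → w i s * g s)) ≡ 0ℚ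
  regroup g = begin
    sumF (λ i → c i * sumF (λ s → w i s * g s))
      ≡⟨ sumF-*ˡ-comm c (λ i s → w i s * g s) ⟩
    sumF (λ s → sumF (λ i → c i * (w i s * g s)))
      ≡⟨ sumF-cong (λ s → sumF-cong (λ i → trans (x∙yz≈y∙xz (c i) (w i s) (g s)) (sym (*-assoc (w i s) (c i) (g s))))) ⟩
    sumF (λ s → sumF (λ i → w i s * c i * g s))
      ≡⟨ sumF-cong (λ s → trans (sumF-*ʳ (g s) (λ i → w i s * c i)) (trans (cong (_* g s) (Σwc≡0 s)) (*-zeroˡ (g s)))) ⟩
    sumF {t} (λ _ → 0ℚ)
      ≡⟨ sumF-0 t ⟩
    0ℚ ∎

  Σc≡0 : sumF c ≡ 0ℚ
  Σc≡0 = trans (sumF-cong (λ i → sym (trans (cong (c i *_) (trans (sumF-cong (λ s → *-identityʳ (w i s))) (w-sum i))) (*-identityʳ (c i)))))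
               (regroup (λ _ → 1ℚ))

  Σcy≡0 : ∀ j → sumF (λ i → c i * y i j) ≡ 0ℚ
  Σcy≡0 j = trans (sumF-cong (λ i → cong (c i *_) (y≡ i j))) (regroup (λ s → u s j))

Hull⊆Aff : ∀ {m} {S : PSet m} {x} → Hull S x → Aff S x
Hull⊆Aff (k , v , w , v∈S , _ , w-sum , x≡) = k , v , w , v∈S , w-sum , x≡

S⊆Hull : ∀ {m} {S : PSet m} {x} → S x → Hull S x
S⊆Hull {x = x} x∈S = 1 , (λ _ → x) , (λ _ → 1ℚ) , (λ _ → x∈S) , (λ _ → ℕ→ℚ-mono-≤ {0} {1} z≤n) ,
                     +-identityʳ 1ℚ , (λ j → sym (trans (+-identityʳ (1ℚ * x j)) (*-identityˡ (x j))))

Aff-sumF : ∀ {m} {S : PSet m} {K} → (∀ {x} → S x → sumF x ≡ K) → ∀ {z} → Aff S z → sumF z ≡ K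
Aff-sumF S-sum (k , v , w , v∈S , w-sum , z≡) =
  trans (sumF-cong z≡) (affineCombination-sumF v w w-sum (λ i → S-sum (v∈S i)))

Hull-coord-≤ : ∀ {m} {S : PSet m} {j c} → (∀ {x} → S x → x j ≤ c) → ∀ {x} → Hull S x → x j ≤ c
Hull-coord-≤ {j = j} {c} S≤c (k , v , w , v∈S , 0≤w , w-sum , x≡) =
  subst (_≤ c) (sym (x≡ j)) (convexCombination-≤ w (λ i → v i j) 0≤w w-sum (λ i → S≤c (v∈S i)))

Hull-coord-nonNeg : ∀ {m} {S : PSet m} {j} → (∀ {x} → S x → 0ℚ ≤ x j) → ∀ {x} → Hull S x → 0ℚ ≤ x j
Hull-coord-nonNeg {j = j} S≥0 (k , v , w , v∈S , 0≤w , w-sum , x≡) =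
  subst (0ℚ ≤_) (sym (x≡ j)) (sumF-nonNeg (λ i → *-nonNeg (0≤w i) (S≥0 (v∈S i))))

-- Counting the entries of a tableau

open SemiringSum ℕₚ.+-*-semiring using ()
  renaming (sum to sumᴺ; ∑-comm to ∑ᴺ-comm; ∑-distrib-+ to ∑ᴺ-distrib-+; sum-cong-≗ to sumᴺ-cong-≗)

sumℕ≗sumᴺ : ∀ {k} (f : Fin k → ℕ) → sumℕ f ≡ sumᴺ f
sumℕ≗sumᴺ {zero}  f = refl
sumℕ≗sumᴺ {suc k} f = cong (f zero ℕ.+_) (sumℕ≗sumᴺ (f ∘ suc))

sumℕ-cong : ∀ {k} {f g : Fin k → ℕ} → (∀ i → f i ≡ g i) → sumℕ f ≡ sumℕ g
sumℕ-cong {zero}  f≗g = refl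
sumℕ-cong {suc k} f≗g = cong₂ ℕ._+_ (f≗g zero) (sumℕ-cong (f≗g ∘ suc))

sumℕ-0 : ∀ k → sumℕ {k} (λ _ → 0) ≡ 0
sumℕ-0 zero    = refl
sumℕ-0 (suc k) = sumℕ-0 k

sumℕ-+ : ∀ {k} (f g : Fin k → ℕ) → sumℕ (λ i → f i ℕ.+ g i) ≡ sumℕ f ℕ.+ sumℕ g
sumℕ-+ f g = begin
  sumℕ (λ i → f i ℕ.+ g i)   ≡⟨ sumℕ≗sumᴺ (λ i → f i ℕ.+ g i) ⟩
  sumᴺ (λ i → f i ℕ.+ g i)   ≡⟨ ∑ᴺ-distrib-+ f g ⟩
  sumᴺ f ℕ.+ sumᴺ g          ≡⟨ cong₂ ℕ._+_ (sumℕ≗sumᴺ f) (sumℕ≗sumᴺ g) ⟨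
  sumℕ f ℕ.+ sumℕ g          ∎
  where open ≡-Reasoning

sumℕ-comm : ∀ {k l} (f : Fin k → Fin l → ℕ) →
            sumℕ (λ i → sumℕ (f i)) ≡ sumℕ (λ j → sumℕ (λ i → f i j))
sumℕ-comm f = begin
  sumℕ (λ i → sumℕ (f i))          ≡⟨ sumℕ≗sumᴺ (λ i → sumℕ (f i)) ⟩
  sumᴺ (λ i → sumℕ (f i))          ≡⟨ sumᴺ-cong-≗ (λ i → sumℕ≗sumᴺ (f i)) ⟩
  sumᴺ (λ i → sumᴺ (f i))          ≡⟨ ∑ᴺ-comm f ⟩
  sumᴺ (λ j → sumᴺ (λ i → f i j))  ≡⟨ sumᴺ-cong-≗ (λ j → sumℕ≗sumᴺ (λ i → f i j)) ⟨
  sumᴺ (λ j → sumℕ (λ i → f i j))  ≡⟨ sumℕ≗sumᴺ (λ j → sumℕ (λ i → f i j)) ⟨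
  sumℕ (λ j → sumℕ (λ i → f i j))  ∎
  where open ≡-Reasoning

bit : Bool → ℕ
bit b = if b then 1 else 0

T-does⇒ : ∀ {A : Set} (a? : Dec A) → T (does a?) → A
T-does⇒ (yes a) _ = a

sumℕ-bit-≟ : ∀ {m} (x : Fin m) → sumℕ (λ k → bit (does (x Fin.≟ k))) ≡ 1
sumℕ-bit-≟ {suc m} zero    = cong suc (sumℕ-0 m)
sumℕ-bit-≟ {suc m} (suc x) = sumℕ-bit-≟ x

sumℕ-bit-≤1 : ∀ {k} (b : Fin k → Bool) → (∀ i i′ → T (b i) → T (b i′) → i ≡ i′) → sumℕ (bit ∘ b) ℕ.≤ 1
sumℕ-bit-≤1 {zero}  b b-unique = z≤n
sumℕ-bit-≤1 {suc k} b b-unique with b zero in b₀≡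
... | false = sumℕ-bit-≤1 (b ∘ suc) (λ i i′ bi bi′ → Finₚ.suc-injective (b-unique (suc i) (suc i′) bi bi′))
... | true  = ℕₚ.≤-reflexive (cong suc (trans (sumℕ-cong rest≡0) (sumℕ-0 k)))
  where
  rest≡0 : ∀ i → bit (b (suc i)) ≡ 0
  rest≡0 i with b (suc i) in bᵢ≡
  ... | false = refl
  ... | true  with () ← b-unique (suc i) zero (Equivalence.from T-≡ bᵢ≡) (Equivalence.from T-≡ b₀≡)

countBelow-cong : ∀ n {f g : ℕ → Bool} → (∀ j → j ℕ.< n → f j ≡ g j) → countBelow n f ≡ countBelow n g
countBelow-cong zero    f≗g = refl
countBelow-cong (suc n) f≗g =
  cong₂ ℕ._+_ (countBelow-cong n (λ j j<n → f≗g j (ℕₚ.m≤n⇒m≤1+n j<n))) (cong bit (f≗g n ℕₚ.≤-refl))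

countBelow-false : ∀ n {f : ℕ → Bool} → (∀ j → f j ≡ false) → countBelow n f ≡ 0
countBelow-false zero    f≡false = refl
countBelow-false (suc n) f≡false = cong₂ ℕ._+_ (countBelow-false n f≡false) (cong bit (f≡false n))

countBelow-extend : ∀ {n w} (f : ℕ → Bool) → n ℕ.≤ w → countBelow n f ≡ countBelow w (λ j → (j ℕ.<ᵇ n) ∧ f j)
countBelow-extend {n} {zero}  f z≤n = refl
countBelow-extend {n} {suc w} f n≤1+w with ℕₚ.m≤n⇒m<n∨m≡n n≤1+w
... | inj₂ refl = countBelow-cong (suc w) (λ j j<n → cong (_∧ f j) (sym (Equivalence.to T-≡ (ℕₚ.<⇒<ᵇ j<n))))
... | inj₁ n<1+w = begin
  countBelow n f
    ≡⟨ countBelow-extend f (ℕₚ.≤-pred n<1+w) ⟩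
  countBelow w (λ j → (j ℕ.<ᵇ n) ∧ f j)
    ≡⟨ ℕₚ.+-identityʳ _ ⟨
  countBelow w (λ j → (j ℕ.<ᵇ n) ∧ f j) ℕ.+ 0
    ≡⟨ cong (λ b → countBelow w (λ j → (j ℕ.<ᵇ n) ∧ f j) ℕ.+ bit (b ∧ f w)) (sym w<ᵇn≡false) ⟩
  countBelow (suc w) (λ j → (j ℕ.<ᵇ n) ∧ f j) ∎
  where
  open ≡-Reasoning
  w<ᵇn≡false : (w ℕ.<ᵇ n) ≡ false
  w<ᵇn≡false with w ℕ.<ᵇ n in eq
  ... | false = refl
  ... | true  = ⊥-elim (ℕₚ.<⇒≱ (ℕₚ.<ᵇ⇒< w n (Equivalence.from T-≡ eq)) (ℕₚ.≤-pred n<1+w))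

sumℕ-countBelow-≤ : ∀ {k} w (g : Fin k → ℕ → Bool) →
  (∀ j → sumℕ (λ i → bit (g i j)) ℕ.≤ 1) → sumℕ (λ i → countBelow w (g i)) ℕ.≤ w
sumℕ-countBelow-≤ {k} zero    g column≤1 = ℕₚ.≤-reflexive (sumℕ-0 k)
sumℕ-countBelow-≤     (suc w) g column≤1 = begin
  sumℕ (λ i → countBelow w (g i) ℕ.+ bit (g i w))          ≡⟨ sumℕ-+ (λ i → countBelow w (g i)) (λ i → bit (g i w)) ⟩
  sumℕ (λ i → countBelow w (g i)) ℕ.+ sumℕ (λ i → bit (g i w))  ≤⟨ ℕₚ.+-mono-≤ (sumℕ-countBelow-≤ w g column≤1) (column≤1 w) ⟩
  w ℕ.+ 1                                                  ≡⟨ ℕₚ.+-comm w 1 ⟩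
  suc w                                                    ∎
  where open ℕₚ.≤-Reasoning

countBelow-≟-total : ∀ {m} n (t : ℕ → Fin m) → sumℕ (λ k → countBelow n (λ j → does (t j Fin.≟ k))) ≡ n
countBelow-≟-total {m} zero    t = sumℕ-0 m
countBelow-≟-total     (suc n) t = begin
  sumℕ (λ k → countBelow n (λ j → does (t j Fin.≟ k)) ℕ.+ bit (does (t n Fin.≟ k)))
    ≡⟨ sumℕ-+ (λ k → countBelow n (λ j → does (t j Fin.≟ k))) (λ k → bit (does (t n Fin.≟ k))) ⟩
  sumℕ (λ k → countBelow n (λ j → does (t j Fin.≟ k))) ℕ.+ sumℕ (λ k → bit (does (t n Fin.≟ k)))
    ≡⟨ cong₂ ℕ._+_ (countBelow-≟-total n t) (sumℕ-bit-≟ (t n)) ⟩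
  n ℕ.+ 1
    ≡⟨ ℕₚ.+-comm n 1 ⟩
  suc n ∎
  where open ≡-Reasoning

sumℕ-expo : ∀ {m} (sh : Fin m → ℕ) τ → sumℕ (expo sh τ) ≡ sumℕ sh
sumℕ-expo sh τ = trans (sumℕ-comm (λ k i → countBelow (sh i) (λ j → does (τ i j Fin.≟ k))))
                       (sumℕ-cong (λ i → countBelow-≟-total (sh i) (τ i)))

SSYT-column-injective : ∀ {m} {sh : Fin m → ℕ} {τ} → IsSSYT sh τ →
  ∀ {i i′ j} → j ℕ.< sh i → j ℕ.< sh i′ → τ i j ≡ τ i′ j → i ≡ i′
SSYT-column-injective {τ = τ} (_ , column-strict) {i} {i′} {j} j<shᵢ j<shᵢ′ τᵢⱼ≡τᵢ′ⱼ
  with ℕₚ.<-cmp (toℕ i) (toℕ i′)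
... | tri< i<i′ _ _ = ⊥-elim (ℕₚ.<-irrefl (cong toℕ τᵢⱼ≡τᵢ′ⱼ) (column-strict i i′ j i<i′ j<shᵢ′))
... | tri≈ _ i≡i′ _ = Finₚ.toℕ-injective i≡i′
... | tri> _ _ i′<i = ⊥-elim (ℕₚ.<-irrefl (cong toℕ (sym τᵢⱼ≡τᵢ′ⱼ)) (column-strict i′ i j i′<i j<shᵢ))

-- Column strictness puts at most one entry k in each column.
expo-≤-width : ∀ {m} {sh : Fin m → ℕ} {τ} {w} → IsSSYT sh τ → (∀ i → sh i ℕ.≤ w) → ∀ k → expo sh τ k ℕ.≤ w
expo-≤-width {sh = sh} {τ} {w} ssyt sh≤w k = begin
  expo sh τ k                       ≡⟨ sumℕ-cong (λ i → countBelow-extend (λ j → does (τ i j Fin.≟ k)) (sh≤w i)) ⟩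
  sumℕ (λ i → countBelow w (cell i)) ≤⟨ sumℕ-countBelow-≤ w cell (λ j → sumℕ-bit-≤1 (λ i → cell i j) (at-most-once j)) ⟩
  w                                 ∎
  where
  open ℕₚ.≤-Reasoning
  cell : Fin _ → ℕ → Bool
  cell i j = (j ℕ.<ᵇ sh i) ∧ does (τ i j Fin.≟ k)
  unpack : ∀ {i j} → T (cell i j) → j ℕ.< sh i × τ i j ≡ k
  unpack {i} {j} c with Equivalence.to T-∧ c
  ... | j<sh , τᵢⱼ≡k = ℕₚ.<ᵇ⇒< j (sh i) j<sh , T-does⇒ (τ i j Fin.≟ k) τᵢⱼ≡k
  at-most-once : ∀ j i i′ → T (cell i j) → T (cell i′ j) → i ≡ i′
  at-most-once j i i′ c c′ with unpack c | unpack c′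
  ... | j<shᵢ , τᵢⱼ≡k | j<shᵢ′ , τᵢ′ⱼ≡k = SSYT-column-injective ssyt j<shᵢ j<shᵢ′ (trans τᵢⱼ≡k (sym τᵢ′ⱼ≡k))

-- The shape (m, …, m, 0) and the tableaux of its vertices

lam-≤ : ∀ m i → lam m i ℕ.≤ m
lam-≤ m i with suc (toℕ i) ℕ.<ᵇ m
... | true  = ℕₚ.≤-refl
... | false = z≤n

lam-support : ∀ {m} (i : Fin m) {j} → j ℕ.< lam m i → suc (toℕ i) ℕ.< m
lam-support {m} i j<λᵢ with suc (toℕ i) ℕ.<ᵇ m in eq
... | true  = ℕₚ.<ᵇ⇒< (suc (toℕ i)) m (Equivalence.from T-≡ eq)
... | false = ⊥-elim (ℕₚ.n≮0 j<λᵢ)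

sumℕ-threshold : ∀ n t a → sumℕ {n} (λ i → if toℕ i ℕ.<ᵇ t then a else 0) ≡ (n ℕ.⊓ t) ℕ.* a
sumℕ-threshold zero    t       a = refl
sumℕ-threshold (suc n) zero    a = trans (sumℕ-threshold n zero a) (cong (ℕ._* a) (ℕₚ.⊓-zeroʳ n))
sumℕ-threshold (suc n) (suc t) a = cong (a ℕ.+_) (sumℕ-threshold n t a)

sumℕ-lam : ∀ N → sumℕ (lam (suc N)) ≡ N ℕ.* suc N
sumℕ-lam N = trans (sumℕ-threshold (suc N) N (suc N)) (cong (ℕ._* suc N) (ℕₚ.m≥n⇒m⊓n≡n (ℕₚ.n≤1+n N)))

toℕ-pinch-fromℕ : ∀ {n} (i : Fin (suc (suc n))) → toℕ i ℕ.≤ n → toℕ (pinch (fromℕ n) i) ≡ toℕ i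
toℕ-pinch-fromℕ         zero    _         = refl
toℕ-pinch-fromℕ {suc n} (suc i) (s≤s i≤n) = cong suc (toℕ-pinch-fromℕ i i≤n)

punchIn-mono-< : ∀ {n} (i : Fin (suc n)) (j k : Fin n) → toℕ j ℕ.< toℕ k → toℕ (punchIn i j) ℕ.< toℕ (punchIn i k)
punchIn-mono-< zero    j       k       j<k       = s≤s j<k
punchIn-mono-< (suc i) zero    (suc k) _         = s≤s z≤n
punchIn-mono-< (suc i) (suc j) (suc k) (s≤s j<k) = s≤s (punchIn-mono-< i j k j<k)

-- Row i holds the i-th element of Fin (n + 2) ∖ {k}: pinch (fromℕ n) is the identity on the first
-- n + 1 rows, the nonempty ones of lam (n + 2).
vertexTableau : ∀ {n} → Fin (suc (suc n)) → Fin (suc (suc n)) → ℕ → Fin (suc (suc n))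
vertexTableau {n} k i _ = punchIn k (pinch (fromℕ n) i)

vertexTableau-SSYT : ∀ {n} (k : Fin (suc (suc n))) → IsSSYT (lam (suc (suc n))) (vertexTableau k)
vertexTableau-SSYT {n} k = (λ _ _ _ _ _ → ℕₚ.≤-refl) , column-strict
  where
  column-strict : ∀ i i′ j → toℕ i ℕ.< toℕ i′ → j ℕ.< lam (suc (suc n)) i′ →
                  toℕ (vertexTableau k i j) ℕ.< toℕ (vertexTableau k i′ j)
  column-strict i i′ j i<i′ j<λᵢ′ = punchIn-mono-< k _ _
    (subst₂ ℕ._<_ (sym (toℕ-pinch-fromℕ i (ℕₚ.≤-trans (ℕₚ.n≤1+n _) (ℕₚ.≤-trans i<i′ i′≤n))))
                  (sym (toℕ-pinch-fromℕ i′ i′≤n)) i<i′)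
    where
    i′≤n : toℕ i′ ℕ.≤ n
    i′≤n = ℕₚ.≤-pred (ℕₚ.≤-pred (lam-support i′ j<λᵢ′))

expo-vertexTableau-self : ∀ {n} (k : Fin (suc (suc n))) → expo (lam (suc (suc n))) (vertexTableau k) k ≡ 0
expo-vertexTableau-self {n} k = trans (sumℕ-cong row-free-of-k) (sumℕ-0 (suc (suc n)))
  where
  row-free-of-k : ∀ i → countBelow (lam (suc (suc n)) i) (λ j → does (vertexTableau k i j Fin.≟ k)) ≡ 0
  row-free-of-k i = countBelow-false (lam (suc (suc n)) i) (λ _ → dec-false (punchIn k p Fin.≟ k) (Finₚ.punchInᵢ≢i k p))
    where p = pinch (fromℕ n) i

-- The Newton polytope of s_λ for λ = (m, …, m, 0), m = n + 2

module Newt-lam (n : ℕ) where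

  N : ℕ
  N = suc n

  m : ℕ
  m = suc N

  P : PSet m
  P = Newt (lam m)

  M : ℚ
  M = ℕ→ℚ m

  K : ℚ
  K = ℕ→ℚ (N ℕ.* m)

  0<M : 0ℚ < M
  0<M = ℕ→ℚ-mono-< {0} {m} (s≤s z≤n)

  M≢0 : M ≢ 0ℚ
  M≢0 M≡0 = <-irrefl (sym M≡0) 0<M

  instance
    M-nonZero : NonZero M
    M-nonZero = ≢-nonZero M≢0

  M⁻¹ : ℚ
  M⁻¹ = 1/ M

  0<M⁻¹ : 0ℚ < M⁻¹
  0<M⁻¹ = positive⁻¹ M⁻¹ {{1/pos⇒pos M {{positive 0<M}}}}

  M≡N+1 : M ≡ ℕ→ℚ N + 1ℚ
  M≡N+1 = trans (cong ℕ→ℚ (ℕₚ.+-comm 1 N)) (ℕ→ℚ-+ N 1)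

  K≡N*M : K ≡ ℕ→ℚ N * M
  K≡N*M = ℕ→ℚ-* N m

  sumF-M- : ∀ (y : Point m) → sumF y ≡ K → sumF (λ k → M - y k) ≡ M
  sumF-M- y y-sum = begin
    sumF (λ k → M - y k)       ≡⟨ sumF-- (λ _ → M) y ⟩
    sumF {m} (λ _ → M) - sumF y ≡⟨ cong₂ _-_ (sumF-const m M) y-sum ⟩
    M * M - K                  ≡⟨ cong₂ (λ u v → u * M - v) M≡N+1 K≡N*M ⟩
    (ℕ→ℚ N + 1ℚ) * M - ℕ→ℚ N * M ≡⟨ solve 2 (λ x y → (y :+ con 1ℚ) :* x :- y :* x := x) refl M (ℕ→ℚ N) ⟩
    M                          ∎
    where
    open ≡-Reasoning
    open +-*-Solver

  SchurExps-nonNeg : ∀ {x} → SchurExps (lam m) x → ∀ j → 0ℚ ≤ x j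
  SchurExps-nonNeg (τ , _ , x≡) j = subst (0ℚ ≤_) (sym (x≡ j)) (ℕ→ℚ-mono-≤ {0} {expo (lam m) τ j} z≤n)

  SchurExps-≤M : ∀ {x} → SchurExps (lam m) x → ∀ j → x j ≤ M
  SchurExps-≤M (τ , ssyt , x≡) j = subst (_≤ M) (sym (x≡ j)) (ℕ→ℚ-mono-≤ (expo-≤-width ssyt (lam-≤ m) j))

  SchurExps-sumF : ∀ {x} → SchurExps (lam m) x → sumF x ≡ K
  SchurExps-sumF {x} (τ , _ , x≡) = begin
    sumF x                           ≡⟨ sumF-cong x≡ ⟩
    sumF (ℕ→ℚ ∘ expo (lam m) τ)      ≡⟨ sumF-ℕ→ℚ (expo (lam m) τ) ⟩
    ℕ→ℚ (sumℕ (expo (lam m) τ))      ≡⟨ cong ℕ→ℚ (trans (sumℕ-expo (lam m) τ) (sumℕ-lam N)) ⟩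
    K                                ∎
    where open ≡-Reasoning

  Newt-nonNeg : ∀ {x} → P x → ∀ j → 0ℚ ≤ x j
  Newt-nonNeg x∈P j = Hull-coord-nonNeg (λ x∈S → SchurExps-nonNeg x∈S j) x∈P

  Newt-≤M : ∀ {x} → P x → ∀ j → x j ≤ M
  Newt-≤M x∈P j = Hull-coord-≤ (λ x∈S → SchurExps-≤M x∈S j) x∈P

  Newt-sumF : ∀ {x} → P x → sumF x ≡ K
  Newt-sumF x∈P = Aff-sumF {S = SchurExps (lam m)} SchurExps-sumF (Hull⊆Aff {S = SchurExps (lam m)} x∈P)

  vertex : Fin m → Point m
  vertex k j = ℕ→ℚ (expo (lam m) (vertexTableau k) j)

  vertex∈SchurExps : ∀ k → SchurExps (lam m) (vertex k)
  vertex∈SchurExps k = vertexTableau k , vertexTableau-SSYT k , λ _ → refl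

  vertex∈Newt : ∀ k → P (vertex k)
  vertex∈Newt k = S⊆Hull {S = SchurExps (lam m)} (vertex∈SchurExps k)

  vertex-self : ∀ k → vertex k k ≡ 0ℚ
  vertex-self k = cong ℕ→ℚ (expo-vertexTableau-self k)

  -- The coordinates of a vertex are at most M and sum to (m - 1) M, and one of them vanishes.
  vertex-other : ∀ {k j} → j ≢ k → vertex k j ≡ M
  vertex-other {k} {j} j≢k = begin
    vertex k j   ≡⟨ solve 2 (λ v x → v := x :- (x :- v)) refl (vertex k j) M ⟩
    M - gap j    ≡⟨ cong (λ u → M - u) gapⱼ≡0 ⟩
    M - 0ℚ       ≡⟨ +-identityʳ M ⟩
    M            ∎
    where
    open ≡-Reasoning
    open +-*-Solver
    gap : Point m
    gap u = M - vertex k u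
    gap-others-sum : sumF (gap ∘ punchIn k) ≡ 0ℚ
    gap-others-sum = +-cancelˡ M (sumF (gap ∘ punchIn k)) 0ℚ (begin
      M + sumF (gap ∘ punchIn k)       ≡⟨ cong (_+ sumF (gap ∘ punchIn k)) (+-identityʳ M) ⟨
      M - 0ℚ + sumF (gap ∘ punchIn k)  ≡⟨ cong (λ u → M - u + sumF (gap ∘ punchIn k)) (vertex-self k) ⟨
      gap k + sumF (gap ∘ punchIn k)  ≡⟨ sumF-remove gap k ⟨
      sumF gap                        ≡⟨ sumF-M- (vertex k) (SchurExps-sumF (vertex∈SchurExps k)) ⟩
      M                               ≡⟨ +-identityʳ M ⟨
      M + 0ℚ                          ∎)
    gapⱼ≡0 : gap j ≡ 0ℚ
    gapⱼ≡0 = subst (λ u → gap u ≡ 0ℚ) (Finₚ.punchIn-punchOut (j≢k ∘ sym))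
      (sumF-nonNeg≡0 (λ t → p≤q⇒0≤q-p (SchurExps-≤M (vertex∈SchurExps k) (punchIn k t))) gap-others-sum (punchOut (j≢k ∘ sym)))

  bary : Point m → Fin m → ℚ
  bary y k = (M - y k) * M⁻¹

  bary-sum : ∀ y → sumF y ≡ K → sumF (bary y) ≡ 1ℚ
  bary-sum y y-sum = trans (sumF-*ʳ M⁻¹ (λ k → M - y k)) (trans (cong (_* M⁻¹) (sumF-M- y y-sum)) (*-inverseʳ M))

  bary-nonNeg : ∀ y k → y k ≤ M → 0ℚ ≤ bary y k
  bary-nonNeg y k yₖ≤M = *-nonNeg (p≤q⇒0≤q-p yₖ≤M) (<⇒≤ 0<M⁻¹)

  bary-coords : ∀ y → sumF y ≡ K → ∀ j → y j ≡ sumF (λ k → bary y k * vertex k j)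
  bary-coords y y-sum j = sym (begin
    sumF (λ k → bary y k * vertex k j)
      ≡⟨ sumF-remove (λ k → bary y k * vertex k j) j ⟩
    bary y j * vertex j j + sumF (λ t → bary y (punchIn j t) * vertex (punchIn j t) j)
      ≡⟨ cong₂ _+_ (cong (bary y j *_) (vertex-self j))
                   (sumF-cong (λ t → cong (bary y (punchIn j t) *_) (vertex-other (Finₚ.punchInᵢ≢i j t ∘ sym)))) ⟩
    bary y j * 0ℚ + sumF (λ t → bary y (punchIn j t) * M)
      ≡⟨ cong (bary y j * 0ℚ +_) (sumF-*ʳ M (bary y ∘ punchIn j)) ⟩
    bary y j * 0ℚ + sumF (bary y ∘ punchIn j) * M
      ≡⟨ cong (λ s → bary y j * 0ℚ + s * M) others ⟩
    bary y j * 0ℚ + (1ℚ - bary y j) * M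
      ≡⟨ solve 3 (λ x i b → (x :- b) :* i :* con 0ℚ :+ (con 1ℚ :- (x :- b) :* i) :* x := x :- (x :- b) :* (i :* x)) refl M M⁻¹ (y j) ⟩
    M - (M - y j) * (M⁻¹ * M)
      ≡⟨ cong (λ u → M - (M - y j) * u) (*-inverseˡ M) ⟩
    M - (M - y j) * 1ℚ
      ≡⟨ solve 2 (λ x b → x :- (x :- b) :* con 1ℚ := b) refl M (y j) ⟩
    y j ∎)
    where
    open ≡-Reasoning
    open +-*-Solver
    others : sumF (bary y ∘ punchIn j) ≡ 1ℚ - bary y j
    others = begin
      sumF (bary y ∘ punchIn j)                         ≡⟨ solve 2 (λ b s → s := b :+ s :- b) refl (bary y j) (sumF (bary y ∘ punchIn j)) ⟩
      bary y j + sumF (bary y ∘ punchIn j) - bary y j   ≡⟨ cong (_- bary y j) (trans (sym (sumF-remove (bary y) j)) (bary-sum y y-sum)) ⟩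
      1ℚ - bary y j                                     ∎

  Newt-intro : ∀ {y} → sumF y ≡ K → (∀ j → y j ≤ M) → P y
  Newt-intro {y} y-sum y≤M =
    m , vertex , bary y , vertex∈SchurExps , (λ k → bary-nonNeg y k (y≤M k)) , bary-sum y y-sum , bary-coords y y-sum

  vertices-AffIndep : ∀ L → L ℕ.≤ m → HasAffIndep P L
  vertices-AffIndep zero    _   = (λ ()) , (λ ()) , λ _ _ _ ()
  vertices-AffIndep (suc L) L≤m = vertex ∘ f , vertex∈Newt ∘ f , indep
    where
    f : Fin (suc L) → Fin m
    f i = Fin.inject≤ i L≤m
    indep : AffIndep (vertex ∘ f)
    indep c Σc≡0 Σcv≡0 i = begin
      c i                          ≡⟨ +-identityʳ (c i) ⟨
      c i + 0ℚ                     ≡⟨ cong (c i +_) others≡0 ⟨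
      c i + sumF (c ∘ punchIn i)   ≡⟨ sumF-remove c i ⟨
      sumF c                       ≡⟨ Σc≡0 ⟩
      0ℚ                           ∎
      where
      open ≡-Reasoning
      f-punchIn≢ : ∀ t → f i ≢ f (punchIn i t)
      f-punchIn≢ t fᵢ≡ = Finₚ.punchInᵢ≢i i t (sym (Finₚ.inject≤-injective L≤m L≤m _ _ fᵢ≡))
      Σcv≡ : sumF (λ i′ → c i′ * vertex (f i′) (f i)) ≡ sumF (c ∘ punchIn i) * M
      Σcv≡ = begin
        sumF (λ i′ → c i′ * vertex (f i′) (f i))
          ≡⟨ sumF-remove (λ i′ → c i′ * vertex (f i′) (f i)) i ⟩
        c i * vertex (f i) (f i) + sumF (λ t → c (punchIn i t) * vertex (f (punchIn i t)) (f i))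
          ≡⟨ cong₂ _+_ (trans (cong (c i *_) (vertex-self (f i))) (*-zeroʳ (c i)))
                       (sumF-cong (λ t → cong (c (punchIn i t) *_) (vertex-other (f-punchIn≢ t)))) ⟩
        0ℚ + sumF (λ t → c (punchIn i t) * M)
          ≡⟨ trans (+-identityˡ _) (sumF-*ʳ M (c ∘ punchIn i)) ⟩
        sumF (c ∘ punchIn i) * M ∎
      others≡0 : sumF (c ∘ punchIn i) ≡ 0ℚ
      others≡0 = *-cancelʳ-≡0 M≢0 (trans (sym Σcv≡) (Σcv≡0 (f i)))

  dim-Newt : ∀ d → ¬ HasAffIndep P (3 ℕ.+ d) → N ℕ.≤ suc d
  dim-Newt d ¬indep with 3 ℕ.+ d ℕ.≤? m
  ... | yes 3+d≤m = ⊥-elim (¬indep (vertices-AffIndep (3 ℕ.+ d) 3+d≤m))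
  ... | no  3+d≰m = ℕₚ.≤-pred (ℕₚ.≤-pred (ℕₚ.≰⇒> 3+d≰m))

  center : Point m
  center _ = ℕ→ℚ N

  center-lattice : LatticePt center
  center-lattice _ = ℤ.+ N , refl

  center-sumF : sumF center ≡ K
  center-sumF = trans (sumF-const m (ℕ→ℚ N)) (trans (*-comm M (ℕ→ℚ N)) (sym K≡N*M))

  center-RelInt : RelInt P center
  center-RelInt = Newt-intro center-sumF (λ _ → ℕ→ℚ-mono-≤ (ℕₚ.n≤1+n N)) , extend
    where
    open +-*-Solver
    instance
      N-nonZero : NonZero (ℕ→ℚ N)
      N-nonZero = ≢-nonZero (λ N≡0 → <-irrefl (sym N≡0) (ℕ→ℚ-mono-< {0} {N} (s≤s z≤n)))
    ε : ℚ
    ε = 1/ ℕ→ℚ N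
    0<ε : 0ℚ < ε
    0<ε = positive⁻¹ ε {{1/pos⇒pos (ℕ→ℚ N) {{positive (ℕ→ℚ-mono-< {0} {N} (s≤s z≤n))}}}}
    extend : ∀ y → P y → Σ ℚ λ ε → (0ℚ < ε) × P (λ j → center j + ε * (center j - y j))
    extend y y∈P = ε , 0<ε , Newt-intro sum-≡ (λ j → 0≤q-p⇒p≤q (subst (0ℚ ≤_) (sym (slack≡ j)) (*-nonNeg (<⇒≤ 0<ε) (Newt-nonNeg y∈P j))))
      where
      open ≡-Reasoning
      sum-≡ : sumF (λ j → center j + ε * (center j - y j)) ≡ K
      sum-≡ = begin
        sumF (λ j → center j + ε * (center j - y j))         ≡⟨ sumF-+ center (λ j → ε * (center j - y j)) ⟩
        sumF center + sumF (λ j → ε * (center j - y j))      ≡⟨ cong (sumF center +_) (sumF-*ˡ ε (λ j → center j - y j)) ⟩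
        sumF center + ε * sumF (λ j → center j - y j)        ≡⟨ cong (λ s → sumF center + ε * s) (sumF-- center y) ⟩
        sumF center + ε * (sumF center - sumF y)             ≡⟨ cong₂ (λ s t → s + ε * (s - t)) center-sumF (Newt-sumF y∈P) ⟩
        K + ε * (K - K)                                     ≡⟨ solve 2 (λ k e → k :+ e :* (k :- k) := k) refl K ε ⟩
        K                                                   ∎
      slack≡ : ∀ j → M - (ℕ→ℚ N + ε * (ℕ→ℚ N - y j)) ≡ ε * y j
      slack≡ j = begin
        M - (ℕ→ℚ N + ε * (ℕ→ℚ N - y j))
          ≡⟨ cong (λ u → u - (ℕ→ℚ N + ε * (ℕ→ℚ N - y j))) M≡N+1 ⟩
        ℕ→ℚ N + 1ℚ - (ℕ→ℚ N + ε * (ℕ→ℚ N - y j))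
          ≡⟨ solve 3 (λ n e x → n :+ con 1ℚ :- (n :+ e :* (n :- x)) := con 1ℚ :- n :* e :+ e :* x) refl (ℕ→ℚ N) ε (y j) ⟩
        1ℚ - ℕ→ℚ N * ε + ε * y j
          ≡⟨ cong (λ u → 1ℚ - u + ε * y j) (*-inverseʳ (ℕ→ℚ N)) ⟩
        1ℚ - 1ℚ + ε * y j
          ≡⟨ cong (_+ ε * y j) (+-inverseʳ 1ℚ) ⟩
        0ℚ + ε * y j
          ≡⟨ +-identityˡ (ε * y j) ⟩
        ε * y j ∎

  module _ {a : Point m} {b : ℚ} (a-supports : Supporting P a b) where

    slack : Fin m → ℚ
    slack k = dot a (vertex k) - b

    slack-nonNeg : ∀ k → 0ℚ ≤ slack k
    slack-nonNeg k = p≤q⇒0≤q-p (a-supports (vertex k) (vertex∈Newt k))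

    slack-expansion : ∀ y → sumF y ≡ K → sumF (λ k → bary y k * slack k) ≡ dot a y - b
    slack-expansion y y-sum = dot-affineCombination vertex (bary y) (bary-sum y y-sum) (bary-coords y y-sum) a b

    face-coord : ∀ {x} → Face P a b x → ∀ k → slack k ≢ 0ℚ → x k ≡ M
    face-coord {x} (x∈P , a·x≡b) k slackₖ≢0 =
      sym (p-q≡0⇒p≡q M (x k) (*-cancelʳ-≡0 (λ M⁻¹≡0 → <-irrefl (sym M⁻¹≡0) 0<M⁻¹) (*-cancelʳ-≡0 slackₖ≢0 termₖ≡0)))
      where
      termₖ≡0 : bary x k * slack k ≡ 0ℚ
      termₖ≡0 = sumF-nonNeg≡0 (λ k → *-nonNeg (bary-nonNeg x k (Newt-≤M x∈P k)) (slack-nonNeg k))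
        (trans (slack-expansion x (Newt-sumF x∈P)) (trans (cong (_- b) a·x≡b) (+-inverseʳ b))) k

    -- Two nonzero slacks would confine the face to the affine hull of the remaining m - 2 vertices.
    face-slack-unique : ∀ {d} → HasAffIndep (Face P a b) (suc d) → N ℕ.≤ suc d →
                        ∀ {k l} → k ≢ l → slack k ≢ 0ℚ → slack l ≢ 0ℚ → ⊥
    face-slack-unique {d} (y , y∈F , y-indep) N≤1+d {k} {l} k≢l slackₖ≢0 slackₗ≢0 =
      affineCombinations-¬AffIndep (vertex ∘ e) y w w-sum y≡ N≤1+d y-indep
      where
      e : Fin n → Fin m
      e = punchIn k ∘ punchIn (punchOut k≢l)
      y-sum : ∀ i → sumF (y i) ≡ K
      y-sum i = Newt-sumF (proj₁ (y∈F i))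
      bary≡0 : ∀ i {j} → slack j ≢ 0ℚ → bary (y i) j ≡ 0ℚ
      bary≡0 i {j} slackⱼ≢0 = begin
        (M - y i j) * M⁻¹  ≡⟨ cong (λ u → (M - u) * M⁻¹) (face-coord (y∈F i) j slackⱼ≢0) ⟩
        (M - M) * M⁻¹      ≡⟨ cong (_* M⁻¹) (+-inverseʳ M) ⟩
        0ℚ * M⁻¹           ≡⟨ *-zeroˡ M⁻¹ ⟩
        0ℚ                 ∎
        where open ≡-Reasoning
      w : Fin (suc d) → Fin n → ℚ
      w i s = bary (y i) (e s)
      w-sum : ∀ i → sumF (w i) ≡ 1ℚ
      w-sum i = trans (sym (sumF-remove₂-0 (bary (y i)) k≢l (bary≡0 i slackₖ≢0) (bary≡0 i slackₗ≢0)))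
                      (bary-sum (y i) (y-sum i))
      y≡ : ∀ i j → y i j ≡ sumF (λ s → w i s * vertex (e s) j)
      y≡ i j = trans (bary-coords (y i) (y-sum i) j)
        (sumF-remove₂-0 (λ k′ → bary (y i) k′ * vertex k′ j) k≢l (term≡0 slackₖ≢0) (term≡0 slackₗ≢0))
        where
        term≡0 : ∀ {k′} → slack k′ ≢ 0ℚ → bary (y i) k′ * vertex k′ j ≡ 0ℚ
        term≡0 {k′} slack≢0 = trans (cong (_* vertex k′ j) (bary≡0 i slack≢0)) (*-zeroˡ (vertex k′ j))

    facet-height : ∀ {d} → ¬ HasAffIndep P (3 ℕ.+ d) → HasAffIndep (Face P a b) (suc d) →
                   ∀ k₀ → slack k₀ ≢ 0ℚ → ∀ y → sumF y ≡ K → bary y k₀ * slack k₀ ≡ dot a y - b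
    facet-height {d} ¬P-indep F-indep k₀ slackₖ₀≢0 y y-sum =
      trans (sym (sumF-single (λ k → bary y k * slack k) k₀ other-terms≡0)) (slack-expansion y y-sum)
      where
      other-terms≡0 : ∀ k → k ≢ k₀ → bary y k * slack k ≡ 0ℚ
      other-terms≡0 k k≢k₀ = trans (cong (bary y k *_) slackₖ≡0) (*-zeroʳ (bary y k))
        where
        slackₖ≡0 : slack k ≡ 0ℚ
        slackₖ≡0 = decidable-stable (slack k ≟ 0ℚ)
          (λ slackₖ≢0 → face-slack-unique F-indep (dim-Newt d ¬P-indep) k≢k₀ slackₖ≢0 slackₖ₀≢0)

    -- With s the only nonzero slack, a·y - b = (M - y k₀) s / M on aff P; at the center this is s / M,
    -- so b < a·z < a·center forces m - 1 < z k₀ < m.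
    no-lattice-point-beyond : ∀ {d} → ¬ HasAffIndep P (3 ℕ.+ d) → HasAffIndep (Face P a b) (suc d) →
      ∀ {z} → LatticePt z → Aff P z → b < dot a z → dot a z < dot a center → ⊥
    no-lattice-point-beyond {d} ¬P-indep F-indep {z} z-int z-aff b<a·z a·z<a·c =
      no-integer-between (z-int k₀) (ℤ.+ N) N<zₖ₀ zₖ₀<N+1
      where
      open +-*-Solver
      z-sum : sumF z ≡ K
      z-sum = Aff-sumF {S = P} Newt-sumF z-aff
      some-slack≢0 : ¬ (∀ k → slack k ≡ 0ℚ)
      some-slack≢0 slack≡0 = <-irrefl (sym a·z-b≡0) (p<q⇒0<q-p b<a·z)
        where
        a·z-b≡0 : dot a z - b ≡ 0ℚ
        a·z-b≡0 = trans (sym (slack-expansion z z-sum))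
          (trans (sumF-cong (λ k → trans (cong (bary z k *_) (slack≡0 k)) (*-zeroʳ (bary z k)))) (sumF-0 m))
      k₀,slack≢0 : ∃ λ k₀ → slack k₀ ≢ 0ℚ
      k₀,slack≢0 = Finₚ.¬∀⟶∃¬ m (λ k → slack k ≡ 0ℚ) (λ k → slack k ≟ 0ℚ) some-slack≢0
      k₀ : Fin m
      k₀ = proj₁ k₀,slack≢0
      s : ℚ
      s = slack k₀
      instance
        s-nonNeg : NonNegative s
        s-nonNeg = nonNegative (slack-nonNeg k₀)
        M⁻¹-nonNeg : NonNegative M⁻¹
        M⁻¹-nonNeg = nonNegative (<⇒≤ 0<M⁻¹)
      height : ∀ y → sumF y ≡ K → bary y k₀ * s ≡ dot a y - b
      height = facet-height ¬P-indep F-indep k₀ (proj₂ k₀,slack≢0)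
      bary-center : bary center k₀ ≡ 1ℚ * M⁻¹
      bary-center = cong (_* M⁻¹) (trans (cong (_- ℕ→ℚ N) M≡N+1) (solve 1 (λ x → x :+ con 1ℚ :- x := con 1ℚ) refl (ℕ→ℚ N)))
      0<M-zₖ₀ : 0ℚ < M - z k₀
      0<M-zₖ₀ = *-cancelʳ-<-nonNeg M⁻¹ (subst (_< bary z k₀) (sym (*-zeroˡ M⁻¹))
        (*-cancelʳ-<-nonNeg s (subst₂ _<_ (sym (*-zeroˡ s)) (sym (height z z-sum)) (p<q⇒0<q-p b<a·z))))
      M-zₖ₀<1 : M - z k₀ < 1ℚ
      M-zₖ₀<1 = *-cancelʳ-<-nonNeg M⁻¹ (subst (bary z k₀ <_) bary-center
        (*-cancelʳ-<-nonNeg s (subst₂ _<_ (sym (height z z-sum)) (sym (height center center-sumF)) (+-monoˡ-< (- b) a·z<a·c))))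
      N<zₖ₀ : ℕ→ℚ N < z k₀
      N<zₖ₀ = 0<q-p⇒p<q (subst (0ℚ <_) 1-[M-z]≡z-N (p<q⇒0<q-p M-zₖ₀<1))
        where
        1-[M-z]≡z-N : 1ℚ - (M - z k₀) ≡ z k₀ - ℕ→ℚ N
        1-[M-z]≡z-N = trans (cong (λ u → 1ℚ - (u - z k₀)) M≡N+1)
          (solve 2 (λ x y → con 1ℚ :- (y :+ con 1ℚ :- x) := x :- y) refl (z k₀) (ℕ→ℚ N))
      zₖ₀<N+1 : z k₀ < ℕ→ℚ N + 1ℚ
      zₖ₀<N+1 = subst (z k₀ <_) M≡N+1 (0<q-p⇒p<q 0<M-zₖ₀)

proposition4p2 : (m : ℕ) → 2 ℕ.≤ m → IsReflexive (Newt {m} (lam m))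
proposition4p2 (suc zero)    (s≤s ())
proposition4p2 (suc (suc n)) _ = center , center-lattice , center-RelInt ,
  λ { a b (a-supports , d , (_ , ¬P-indep) , (F-indep , _)) (z , z-int , z-aff , b<a·z , a·z<a·c) →
        no-lattice-point-beyond {a} {b} a-supports ¬P-indep F-indep z-int z-aff b<a·z a·z<a·c }
  where open Newt-lam n
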